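{- Let $G$ be a graph having matching width $t$, and let $F=CNF(G)$. Then for any permutation $SF$ of $Var(F)$ there is a prefix $SF_1$ of $SF$ such that there are at least $2^t$ pairwise different functions of the form $F_{S_1}$, where $S_1$ ranges over truth assignments to the variables of $SF_1$.
   Context: $CNF(G)$ has a variable $X_u$ for each vertex $u\in V(G)$ and a variable $X_{u,v}=X_{v,u}$ for each edge $\{u,v\}\in E(G)$, and a clause $(X_u \vee X_{u,v} \vee X_v)$ for each edge $\{u,v\}$. $Var(F)$ is the set of variables of $F$. For a truth assignment $S$ to a subset of $Var(F)$ (viewed as a consistent set of literals), $F_S$ is the Boolean function on $Var(F)\setminus Var(S)$ whose satisfying assignments are those $S'$ such that $S\cup S'$ satisfies $F$. Matching width: for a permutation $SV$ of $V(G)$ and a prefix $S_1$, the matching width of $S_1$ is the maximum size of a matching consisting of edges between $S_1$ and $V(G)\setminus S_1$; the matching width of $SV$ is the maximum over its prefixes; the matching width of $G$ is the minimum over all permutations of $V(G)$. -}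

module Defs where

open import Data.Nat using (ℕ; _+_; _≤_; _<ᵇ_)
open import Data.Fin using (Fin; toℕ)
open import Data.Fin.Permutation using (Permutation′; _⟨$⟩ˡ_)
open import Data.Bool using (Bool; true; false; _∧_; _∨_; if_then_else_)
open import Data.Product using (Σ; _×_; _,_; proj₁; proj₂)
open import Data.Sum using (_⊎_; inj₁; inj₂)
open import Data.List using (List; length)
open import Data.List.Relation.Unary.All using (All)
open import Data.List.Relation.Unary.AllPairs using (AllPairs)
open import Relation.Binary.PropositionalEquality using (_≡_; _≢_)
open import Relation.Nullary using (¬_)
open import Function.Bundles using (_↔_; Inverse)

record Graph (n m : ℕ) : Set where
  field
    endpoints : Fin m → Fin n × Fin n
    noLoop    : ∀ e → proj₁ (endpoints e) ≢ proj₂ (endpoints e)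
    noMulti   : ∀ e e' → e ≢ e' →
                  ¬ (endpoints e ≡ endpoints e')
                × ¬ (endpoints e ≡ (proj₂ (endpoints e') , proj₁ (endpoints e')))
open Graph public

-- u lies in the prefix of length k of the vertex ordering π
-- (π ⟨$⟩ʳ i is the vertex at position i).
inPrefixV : ∀ {n} → Permutation′ n → ℕ → Fin n → Bool
inPrefixV π k u = toℕ (π ⟨$⟩ˡ u) <ᵇ k

VertexDisjoint : ∀ {n m} → Graph n m → Fin m → Fin m → Set
VertexDisjoint G e f =
  let (a , b) = endpoints G e ; (c , d) = endpoints G f in
  (a ≢ c) × (a ≢ d) × (b ≢ c) × (b ≢ d)

Crossing : ∀ {n m} → Graph n m → Permutation′ n → ℕ → Fin m → Set
Crossing G π k e =
  inPrefixV π k (proj₁ (endpoints G e)) ≢ inPrefixV π k (proj₂ (endpoints G e))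

-- a matching consisting of edges between the prefix of length k and its complement
-- (pairwise vertex-disjoint edges; this also forces the edges to be distinct)
CutMatching : ∀ {n m} → Graph n m → Permutation′ n → ℕ → List (Fin m) → Set
CutMatching G π k M = All (Crossing G π k) M × AllPairs (VertexDisjoint G) M

-- mw(π) = max over prefixes k ≤ n of the maximum size of such a matching;
-- mw(G) = min over permutations π.  "mw(G) = t" unfolds to:
--  * some π has every prefix-cut matching of size ≤ t, and
--  * every π has some prefix with a cut matching of size t.
HasMatchingWidth : ∀ {n m} → Graph n m → ℕ → Set
HasMatchingWidth {n} G t =
  (Σ (Permutation′ n) λ π → ∀ k → k ≤ n → ∀ M → CutMatching G π k M → length M ≤ t)
  × (∀ (π : Permutation′ n) → Σ ℕ λ k → k ≤ n × Σ (List _) λ M → CutMatching G π k M × length M ≡ t)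

-- Var(CNF(G)): X_u for u : Fin n (inj₁) and X_e for each edge e (inj₂).
Var : ℕ → ℕ → Set
Var n m = Fin n ⊎ Fin m

Assignment : ℕ → ℕ → Set
Assignment n m = Var n m → Bool

clause : ∀ {n m} → Graph n m → Assignment n m → Fin m → Bool
clause G α e = α (inj₁ (proj₁ (endpoints G e))) ∨ α (inj₂ e) ∨ α (inj₁ (proj₂ (endpoints G e)))

sat : ∀ {n m} → Graph n m → Assignment n m → Bool
sat {m = m} G α = allFin (clause G α)
  where
  open import Data.Fin using (zero; suc)
  allFin : ∀ {j} → (Fin j → Bool) → Bool
  allFin {ℕ.zero}  f = true
  allFin {ℕ.suc j} f = f zero ∧ allFin (λ i → f (suc i))

VarOrder : ℕ → ℕ → Set
VarOrder n m = Fin (n + m) ↔ Var n m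

inPrefixVar : ∀ {n m} → VarOrder n m → ℕ → Var n m → Bool
inPrefixVar σ k x = toℕ (Inverse.from σ x) <ᵇ k

merge : ∀ {n m} → VarOrder n m → ℕ → Assignment n m → Assignment n m → Assignment n m
merge σ k S S' x = if inPrefixVar σ k x then S x else S' x

-- F_S for S the restriction of S to Var(SF₁) (prefix of length k):
-- the Boolean function S' ↦ [S ∪ S' satisfies F], where only the values of
-- S' outside Var(SF₁) matter.
restrict : ∀ {n m} → Graph n m → VarOrder n m → ℕ → Assignment n m → Assignment n m → Bool
restrict G σ k S S' = sat G (merge σ k S S')

SameFunction : ∀ {n m} → Graph n m → VarOrder n m → ℕ → Assignment n m → Assignment n m → Set
SameFunction G σ k S T = ∀ S' → restrict G σ k S S' ≡ restrict G σ k T S'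

module Submission where

-- Ordering the vertices u by the position of X_u in SF gives a vertex
-- ordering π whose prefixes are exactly the vertex parts of prefixes of SF
-- (induced-vertex-order).  Since mw(G) = t, some prefix of π is crossed by a
-- matching M with |M| = t; let SF₁ be the corresponding prefix of SF.  Each
-- edge e of M has an inner endpoint in_e (X_{in_e} ∈ SF₁) and an outer one
-- out_e (X_{out_e} ∉ SF₁).  For a set C ⊆ M let S_C falsify exactly X_{in_e}
-- and X_e for e ∈ C, and for e ∈ M let the probe T_e falsify exactly X_{out_e}
-- and X_e.  Then S_C ∪ T_e satisfies CNF(G) iff e ∉ C: for e ∈ C the clause
-- of e is false, while for e ∉ C disjointness of the edges of M keeps every
-- clause true (restrict-probe).  Hence different C give different
-- restrictions (separated-family), and the 2^t subsets of M are indexed by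
-- Fin (2 ^ t) through binary digits (subset-separates).

open import Defs
open import Data.Nat using (ℕ; zero; suc; _+_; _^_; _≤_; _<_; _<ᵇ_)
open import Data.Nat.Properties as ℕₚ using (_<?_; <ᵇ⇒<; <⇒<ᵇ)
open import Data.Fin as Fin using (Fin; toℕ; fromℕ<; punchOut; combine; finToFun; funToFin)
open import Data.Fin.Properties as Finₚ
  using (toℕ<n; toℕ-fromℕ<; suc-injective; punchOut-injective; injective⇒≤; any?;
         ¬∀⟶∃¬; funToFin-finToFin; 2↔Bool)
open import Data.Fin.Subset using (Subset; ∣_∣; _∈_; _⊂_)
open import Data.Fin.Subset.Properties using (∈⊤; ∣⊤∣≡n; p⊂q⇒∣p∣<∣q∣)
open import Data.Fin.Permutation using (Permutation′)
open import Data.Vec using (tabulate)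
open import Data.Vec.Properties using (lookup∘tabulate; []=⇒lookup; lookup⇒[]=)
open import Data.Bool as Bool using (Bool; true; false; not; _∧_; _∨_; T; T?)
open import Data.Bool.Properties using (∨-comm; ∨-assoc; ∨-zeroʳ; ∧-zeroʳ; not-injective; T-≡)
open import Data.Product using (Σ; ∃; _×_; _,_; proj₁; proj₂)
open import Data.Sum using (_⊎_; inj₁; inj₂; [_,_])
open import Data.Sum.Properties using (inj₁-injective)
open import Data.List using (List; length; lookup)
open import Data.List.Membership.Propositional.Properties using (∈-lookup)
open import Data.List.Relation.Unary.All as All using (All)
open import Data.List.Relation.Unary.AllPairs using (AllPairs; _∷_)
open import Function using (_∘_; const)
open import Function.Bundles using (Inverse; Injection; mk↔ₛ′; _⇔_; mk⇔; Equivalence)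
open import Function.Properties.Inverse using (↔-sym; ↔⇒↣)
open import Function.Definitions using (Injective)
open import Relation.Binary using (Symmetric; tri<; tri≈; tri>)
open import Relation.Binary.PropositionalEquality
  using (_≡_; _≢_; refl; sym; trans; cong; cong₂; subst; module ≡-Reasoning)
open import Relation.Nullary using (¬_; Dec; yes; no; does; contradiction)
open import Relation.Nullary.Decidable using (dec-true; dec-false; does-⇔; _×-dec_)

private
  variable
    n m N t : ℕ

-- G without its first edge; its CNF is the tail of the conjunction defining
-- sat, which makes induction on the number of edges possible.
dropFirstEdge : Graph n (suc m) → Graph n m
dropFirstEdge G = record
  { endpoints = endpoints G ∘ Fin.suc
  ; noLoop    = noLoop G ∘ Fin.suc
  ; noMulti   = λ e e' e≢e' → noMulti G (Fin.suc e) (Fin.suc e') (e≢e' ∘ suc-injective)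
  }

dropFirstEdgeVar : Assignment n (suc m) → Assignment n m
dropFirstEdgeVar α = [ α ∘ inj₁ , α ∘ inj₂ ∘ Fin.suc ]

sat-true : (G : Graph n m) (α : Assignment n m) →
           (∀ e → clause G α e ≡ true) → sat G α ≡ true
sat-true {m = zero}  G α all-true = refl
sat-true {m = suc m} G α all-true =
  cong₂ _∧_ (all-true Fin.zero)
            (sat-true (dropFirstEdge G) (dropFirstEdgeVar α) (all-true ∘ Fin.suc))

sat-false : (G : Graph n m) (α : Assignment n m) →
            ∀ e → clause G α e ≡ false → sat G α ≡ false
sat-false G α Fin.zero    false-here =
  cong (_∧ sat (dropFirstEdge G) (dropFirstEdgeVar α)) false-here
sat-false G α (Fin.suc e) false-there =
  trans (cong (clause G α Fin.zero ∧_)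
              (sat-false (dropFirstEdge G) (dropFirstEdgeVar α) e false-there))
        (∧-zeroʳ _)

Oriented : Graph n m → Fin m → Fin n → Fin n → Set
Oriented G e u v = endpoints G e ≡ (u , v) ⊎ endpoints G e ≡ (v , u)

∨-reverse : ∀ x y z → x ∨ (y ∨ z) ≡ z ∨ (y ∨ x)
∨-reverse x y z = begin
  x ∨ (y ∨ z)  ≡⟨ ∨-comm x (y ∨ z) ⟩
  (y ∨ z) ∨ x  ≡⟨ cong (_∨ x) (∨-comm y z) ⟩
  (z ∨ y) ∨ x  ≡⟨ ∨-assoc z y x ⟩
  z ∨ (y ∨ x)  ∎
  where open ≡-Reasoning

clause-oriented : ∀ (G : Graph n m) α {e u v} → Oriented G e u v →
                  clause G α e ≡ α (inj₁ u) ∨ α (inj₂ e) ∨ α (inj₁ v)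
clause-oriented G α (inj₁ e≡uv) rewrite e≡uv = refl
clause-oriented G α {e} {u} {v} (inj₂ e≡vu) rewrite e≡vu =
  ∨-reverse (α (inj₁ v)) (α (inj₂ e)) (α (inj₁ u))

clause-false : ∀ (G : Graph n m) α {e u v} → Oriented G e u v →
               α (inj₁ u) ≡ false → α (inj₂ e) ≡ false → α (inj₁ v) ≡ false →
               clause G α e ≡ false
clause-false G α o αu αe αv rewrite clause-oriented G α o | αu | αe | αv = refl

clause-true-edge : ∀ (G : Graph n m) α {e} → α (inj₂ e) ≡ true → clause G α e ≡ true
clause-true-edge G α αe rewrite αe = ∨-zeroʳ _

clause-true-first : ∀ (G : Graph n m) α {e u v} → Oriented G e u v →
                    α (inj₁ u) ≡ true → clause G α e ≡ true
clause-true-first G α o αu rewrite clause-oriented G α o | αu = refl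

clause-true-second : ∀ (G : Graph n m) α {e u v} → Oriented G e u v →
                     α (inj₁ v) ≡ true → clause G α e ≡ true
clause-true-second G α {e} {u} o αv rewrite clause-oriented G α o | αv =
  trans (cong (α (inj₁ u) ∨_) (∨-zeroʳ (α (inj₂ e)))) (∨-zeroʳ (α (inj₁ u)))

Endpoint : Graph n m → Fin m → Fin n → Set
Endpoint G e u = u ≡ proj₁ (endpoints G e) ⊎ u ≡ proj₂ (endpoints G e)

oriented-first : ∀ {G : Graph n m} {e u v} → Oriented G e u v → Endpoint G e u
oriented-first (inj₁ e≡uv) = inj₁ (sym (cong proj₁ e≡uv))
oriented-first (inj₂ e≡vu) = inj₂ (sym (cong proj₂ e≡vu))

oriented-second : ∀ {G : Graph n m} {e u v} → Oriented G e u v → Endpoint G e v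
oriented-second (inj₁ e≡uv) = inj₂ (sym (cong proj₂ e≡uv))
oriented-second (inj₂ e≡vu) = inj₁ (sym (cong proj₁ e≡vu))

disjoint-endpoints : ∀ {G : Graph n m} {e f u w} → VertexDisjoint G e f →
                     Endpoint G e u → Endpoint G f w → u ≢ w
disjoint-endpoints (a≢c , a≢d , b≢c , b≢d) (inj₁ refl) (inj₁ refl) = a≢c
disjoint-endpoints (a≢c , a≢d , b≢c , b≢d) (inj₁ refl) (inj₂ refl) = a≢d
disjoint-endpoints (a≢c , a≢d , b≢c , b≢d) (inj₂ refl) (inj₁ refl) = b≢c
disjoint-endpoints (a≢c , a≢d , b≢c , b≢d) (inj₂ refl) (inj₂ refl) = b≢d

VertexDisjoint-sym : ∀ {G : Graph n m} → Symmetric (VertexDisjoint G)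
VertexDisjoint-sym (a≢c , a≢d , b≢c , b≢d) =
  (a≢c ∘ sym) , (b≢c ∘ sym) , (a≢d ∘ sym) , (b≢d ∘ sym)

-- For a symmetric relation, AllPairs relates the entries at any two
-- distinct positions; this turns a matching given as a list into a family
-- of edges indexed by positions.
AllPairs-lookup : ∀ {A : Set} {R : A → A → Set} {xs : List A} → Symmetric R →
                  AllPairs R xs → ∀ {i j} → i ≢ j → R (lookup xs i) (lookup xs j)
AllPairs-lookup R-sym (x~xs ∷ pairs) {Fin.zero}  {Fin.zero}  i≢j = contradiction refl i≢j
AllPairs-lookup R-sym (x~xs ∷ pairs) {Fin.zero}  {Fin.suc j} i≢j = All.lookup x~xs (∈-lookup j)
AllPairs-lookup R-sym (x~xs ∷ pairs) {Fin.suc i} {Fin.zero}  i≢j =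
  R-sym (All.lookup x~xs (∈-lookup i))
AllPairs-lookup R-sym (x~xs ∷ pairs) {Fin.suc i} {Fin.suc j} i≢j =
  AllPairs-lookup R-sym pairs (i≢j ∘ cong Fin.suc)

record CrossingEnds (G : Graph n m) (P : Fin n → Bool) (e : Fin m) : Set where
  field
    inner     : Fin n
    outer     : Fin n
    oriented  : Oriented G e inner outer
    inner-in  : P inner ≡ true
    outer-out : P outer ≡ false

crossing-ends : ∀ {G : Graph n m} {P : Fin n → Bool} {e} →
                P (proj₁ (endpoints G e)) ≢ P (proj₂ (endpoints G e)) → CrossingEnds G P e
crossing-ends {G = G} {P} {e} crosses
  with P (proj₁ (endpoints G e)) in P-first | P (proj₂ (endpoints G e)) in P-second
... | true  | true  = contradiction refl crosses
... | false | false = contradiction refl crosses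
... | true  | false = record
  { inner = proj₁ (endpoints G e) ; outer = proj₂ (endpoints G e)
  ; oriented = inj₁ refl ; inner-in = P-first ; outer-out = P-second }
... | false | true  = record
  { inner = proj₂ (endpoints G e) ; outer = proj₁ (endpoints G e)
  ; oriented = inj₂ refl ; inner-in = P-second ; outer-out = P-first }

injective⇒surjective : (g : Fin n → Fin n) → Injective _≡_ _≡_ g → ∀ y → ∃ λ x → g x ≡ y
injective⇒surjective {zero}  g g-inj ()
injective⇒surjective {suc n} g g-inj y with any? (λ x → g x Finₚ.≟ y)
... | yes hit = hit
... | no  miss = contradiction (injective⇒≤ h-inj) ℕₚ.1+n≰n
  where
  -- without a preimage of y, g would squeeze Fin (suc n) into Fin n
  avoids : ∀ x → y ≢ g x
  avoids x y≡gx = miss (x , sym y≡gx)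
  h : Fin (suc n) → Fin n
  h x = punchOut (avoids x)
  h-inj : Injective _≡_ _≡_ h
  h-inj = g-inj ∘ punchOut-injective (avoids _) (avoids _)

-- An injection f : Fin n → Fin N orders Fin n: u comes before w iff
-- f u < f w.  The rank of u is the number of elements before it.
module InducedOrder (f : Fin n → Fin N) (f-inj : Injective _≡_ _≡_ f) where

  before : Fin n → Subset n
  before u = tabulate (λ w → toℕ (f w) <ᵇ toℕ (f u))

  ∈-before : ∀ {u w} → w ∈ before u ⇔ f w Fin.< f u
  ∈-before {u} {w} = mk⇔
    (λ w∈ → <ᵇ⇒< _ _ (Equivalence.from T-≡ (trans (sym (lookup∘tabulate _ w)) ([]=⇒lookup w∈))))
    (λ w< → lookup⇒[]= w _ (trans (lookup∘tabulate _ w) (Equivalence.to T-≡ (<⇒<ᵇ w<))))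

  ∉-before-self : ∀ u → ¬ u ∈ before u
  ∉-before-self u = Finₚ.<-irrefl refl ∘ Equivalence.to ∈-before

  before-⊂ : ∀ {u w} → f u Fin.< f w → before u ⊂ before w
  before-⊂ {u} u<w =
    (λ x<u → Equivalence.from ∈-before (Finₚ.<-trans (Equivalence.to ∈-before x<u) u<w)) ,
    u , Equivalence.from ∈-before u<w , ∉-before-self u

  -- u itself is not before u, so fewer than n elements are
  rank-bound : ∀ u → ∣ before u ∣ < n
  rank-bound u = subst (∣ before u ∣ <_) (∣⊤∣≡n n)
    (p⊂q⇒∣p∣<∣q∣ ((λ _ → ∈⊤) , u , ∈⊤ , ∉-before-self u))

  rank : Fin n → Fin n
  rank u = fromℕ< (rank-bound u)

  rank-< : ∀ {u w} → f u Fin.< f w → rank u Fin.< rank w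
  rank-< {u} {w} u<w rewrite toℕ-fromℕ< (rank-bound u) | toℕ-fromℕ< (rank-bound w) =
    p⊂q⇒∣p∣<∣q∣ (before-⊂ u<w)

  rank-reflects : ∀ {u w} → rank u Fin.< rank w → f u Fin.< f w
  rank-reflects {u} {w} r< with Finₚ.<-cmp (f u) (f w)
  ... | tri< u<w _ _ = u<w
  ... | tri≈ _ fu≡fw _ rewrite f-inj fu≡fw = contradiction r< (Finₚ.<-irrefl refl)
  ... | tri> _ _ w<u = contradiction (rank-< w<u) (Finₚ.<-asym r<)

  rank-injective : Injective _≡_ _≡_ rank
  rank-injective {u} {w} r≡ with Finₚ.<-cmp (f u) (f w)
  ... | tri< u<w _ _ = contradiction r≡ (Finₚ.<⇒≢ (rank-< u<w))
  ... | tri≈ _ fu≡fw _ = f-inj fu≡fw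
  ... | tri> _ _ w<u = contradiction (sym r≡) (Finₚ.<⇒≢ (rank-< w<u))

  unrank : Fin n → Fin n
  unrank r = proj₁ (injective⇒surjective rank rank-injective r)

  rank-unrank : ∀ r → rank (unrank r) ≡ r
  rank-unrank r = proj₂ (injective⇒surjective rank rank-injective r)

  order : Permutation′ n
  order = mk↔ₛ′ unrank rank (rank-injective ∘ rank-unrank ∘ rank) rank-unrank

  order-prefix : ∀ k → k ≤ n →
                 ∃ λ K → K ≤ N × ∀ u → inPrefixV order k u ≡ (toℕ (f u) <ᵇ K)
  -- for k = n take all of Fin N; for k < n cut at f of the element of rank k
  order-prefix k k≤n with k <? n
  ... | no k≮n = N , ℕₚ.≤-refl , λ u → does-⇔ (mk⇔ (const (toℕ<n (f u)))
          (const (ℕₚ.<-≤-trans (toℕ<n (rank u)) (ℕₚ.≮⇒≥ k≮n)))) (_ <? k) (_ <? N)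
  ... | yes k<n = toℕ (f w) , ℕₚ.<⇒≤ (toℕ<n (f w)) , λ u →
          does-⇔ (mk⇔ (rank-reflects ∘ subst (toℕ (rank u) <_) (sym rank-w))
                      (subst (toℕ (rank u) <_) rank-w ∘ rank-<))
                 (_ <? k) (_ <? toℕ (f w))
    where
    w : Fin n
    w = unrank (fromℕ< k<n)
    rank-w : toℕ (rank w) ≡ k
    rank-w = trans (cong toℕ (rank-unrank (fromℕ< k<n))) (toℕ-fromℕ< k<n)

vertexInPrefix : VarOrder n m → ℕ → Fin n → Bool
vertexInPrefix σ K u = inPrefixVar σ K (inj₁ u)

vertexPosition : VarOrder n m → Fin n → Fin (n + m)
vertexPosition σ u = Inverse.from σ (inj₁ u)

vertexPosition-injective : (σ : VarOrder n m) → Injective _≡_ _≡_ (vertexPosition σ)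
vertexPosition-injective σ = inj₁-injective ∘ Injection.injective (↔⇒↣ (↔-sym σ))

induced-vertex-order : (σ : VarOrder n m) →
  Σ (Permutation′ n) λ π → ∀ k → k ≤ n →
    ∃ λ K → K ≤ n + m × ∀ u → inPrefixV π k u ≡ vertexInPrefix σ K u
induced-vertex-order σ = order , order-prefix
  where open InducedOrder (vertexPosition σ) (vertexPosition-injective σ)

merge-in : ∀ (σ : VarOrder n m) K S S' {x} → inPrefixVar σ K x ≡ true → merge σ K S S' x ≡ S x
merge-in σ K S S' in-prefix rewrite in-prefix = refl

merge-out : ∀ (σ : VarOrder n m) K S S' {x} → inPrefixVar σ K x ≡ false → merge σ K S S' x ≡ S' x
merge-out σ K S S' out-of-prefix rewrite out-of-prefix = refl

CrossesPrefix : Graph n m → VarOrder n m → ℕ → Fin m → Set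
CrossesPrefix G σ K e =
  vertexInPrefix σ K (proj₁ (endpoints G e)) ≢ vertexInPrefix σ K (proj₂ (endpoints G e))

falsified : ∀ {A : Set} (a? : Dec A) → not (does a?) ≡ false → A
falsified (yes a) _  = a
falsified (no ¬a) ()

module Separation (G : Graph n m) (σ : VarOrder n m) (K : ℕ)
                  (edge : Fin t → Fin m)
                  (ends : ∀ p → CrossingEnds G (vertexInPrefix σ K) (edge p))
                  (disjoint : ∀ {p q} → p ≢ q → VertexDisjoint G (edge p) (edge q)) where

  open module Ends p = CrossingEnds (ends p)

  inner-distinct : ∀ {p q} → p ≢ q → inner p ≢ inner q
  inner-distinct {p} {q} p≢q = disjoint-endpoints {G = G} (disjoint p≢q)
    (oriented-first {G = G} (oriented p)) (oriented-first {G = G} (oriented q))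

  outer-distinct : ∀ {p q} → p ≢ q → outer p ≢ outer q
  outer-distinct {p} {q} p≢q = disjoint-endpoints {G = G} (disjoint p≢q)
    (oriented-second {G = G} (oriented p)) (oriented-second {G = G} (oriented q))

  chosenInner : (c : Fin t → Bool) (u : Fin n) → Dec (∃ λ p → T (c p) × inner p ≡ u)
  chosenInner c u = any? (λ p → T? (c p) ×-dec (inner p Finₚ.≟ u))

  chosenEdge : (c : Fin t → Bool) (f : Fin m) → Dec (∃ λ p → T (c p) × edge p ≡ f)
  chosenEdge c f = any? (λ p → T? (c p) ×-dec (edge p Finₚ.≟ f))

  select : (Fin t → Bool) → Assignment n m
  select c (inj₁ u) = not (does (chosenInner c u))
  select c (inj₂ f) = not (does (chosenEdge c f))

  probe : Fin t → Assignment n m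
  probe q (inj₁ u) = not (does (u Finₚ.≟ outer q))
  probe q (inj₂ f) = not (does (f Finₚ.≟ edge q))

  probe-rejects : ∀ c q → c q ≡ true → restrict G σ K (select c) (probe q) ≡ false
  probe-rejects c q chosen =
    sat-false G α (edge q) (clause-false G α (oriented q) α-inner α-edge α-outer)
    where
    α : Assignment n m
    α = merge σ K (select c) (probe q)
    α-inner : α (inj₁ (inner q)) ≡ false
    α-inner = trans (merge-in σ K (select c) (probe q) (inner-in q))
      (cong not (dec-true (chosenInner c (inner q)) (q , Equivalence.from T-≡ chosen , refl)))
    α-edge : α (inj₂ (edge q)) ≡ false
    α-edge with inPrefixVar σ K (inj₂ (edge q))
    ... | true  = cong not (dec-true (chosenEdge c (edge q)) (q , Equivalence.from T-≡ chosen , refl))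
    ... | false = cong not (dec-true (edge q Finₚ.≟ edge q) refl)
    α-outer : α (inj₁ (outer q)) ≡ false
    α-outer = trans (merge-out σ K (select c) (probe q) (outer-out q))
      (cong not (dec-true (outer q Finₚ.≟ outer q) refl))

  -- If q is not chosen, S_C ∪ T_q satisfies every clause: a false edge
  -- variable X_f either belongs to a chosen edge p ≠ q, whose outer endpoint
  -- is then true, or is X_{edge q}, whose inner endpoint is then true.
  probe-accepts : ∀ c q → c q ≡ false → restrict G σ K (select c) (probe q) ≡ true
  probe-accepts c q unchosen = sat-true G α (λ f → clause-holds f (α (inj₂ f)) refl)
    where
    α : Assignment n m
    α = merge σ K (select c) (probe q)
    chosen≢q : ∀ {p} → T (c p) → p ≢ q
    chosen≢q cp refl = subst T unchosen cp
    false-edge : ∀ f → α (inj₂ f) ≡ false → (∃ λ p → T (c p) × edge p ≡ f) ⊎ f ≡ edge q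
    false-edge f αf with inPrefixVar σ K (inj₂ f)
    ... | true  = inj₁ (falsified (chosenEdge c f) αf)
    ... | false = inj₂ (falsified (f Finₚ.≟ edge q) αf)
    clause-holds : ∀ f b → α (inj₂ f) ≡ b → clause G α f ≡ true
    clause-holds f true αf = clause-true-edge G α αf
    clause-holds f false αf with false-edge f αf
    ... | inj₁ (p , cp , refl) = clause-true-second G α (oriented p)
            (trans (merge-out σ K (select c) (probe q) (outer-out p))
                   (cong not (dec-false (outer p Finₚ.≟ outer q) (outer-distinct (chosen≢q cp)))))
    ... | inj₂ refl = clause-true-first G α (oriented q)
            (trans (merge-in σ K (select c) (probe q) (inner-in q))
                   (cong not (dec-false (chosenInner c (inner q))
                     λ (p , cp , same-inner) → inner-distinct (chosen≢q cp) same-inner)))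

  restrict-probe : ∀ c q → restrict G σ K (select c) (probe q) ≡ not (c q)
  restrict-probe c q with c q in cq
  ... | true  = probe-rejects c q cq
  ... | false = probe-accepts c q cq

  select-separates : ∀ {c c' q} → c q ≢ c' q → ¬ SameFunction G σ K (select c) (select c')
  select-separates {c} {c'} {q} differ same = differ (not-injective (begin
    not (c q)                                ≡⟨ sym (restrict-probe c q) ⟩
    restrict G σ K (select c) (probe q)      ≡⟨ same (probe q) ⟩
    restrict G σ K (select c') (probe q)     ≡⟨ restrict-probe c' q ⟩
    not (c' q)                               ∎))
    where open ≡-Reasoning

subset : Fin (2 ^ t) → Fin t → Bool
subset {t} i p = Inverse.to 2↔Bool (finToFun {2} {t} i p)

funToFin-cong : ∀ {t N} {g h : Fin t → Fin N} → (∀ p → g p ≡ h p) → funToFin g ≡ funToFin h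
funToFin-cong {zero}  g≗h = refl
funToFin-cong {suc t} g≗h = cong₂ combine (g≗h Fin.zero) (funToFin-cong (g≗h ∘ Fin.suc))

finToFun-injective : ∀ N t {i j : Fin (N ^ t)} →
                     (∀ p → finToFun {N} {t} i p ≡ finToFun j p) → i ≡ j
finToFun-injective N t {i} {j} same-digits = begin
  i                               ≡⟨ sym (funToFin-finToFin {t} {N} i) ⟩
  funToFin (finToFun {N} {t} i)   ≡⟨ funToFin-cong same-digits ⟩
  funToFin (finToFun {N} {t} j)   ≡⟨ funToFin-finToFin {t} {N} j ⟩
  j                               ∎
  where open ≡-Reasoning

subset-separates : ∀ t {i j : Fin (2 ^ t)} → i ≢ j → ∃ λ p → subset i p ≢ subset j p
subset-separates t {i} {j} i≢j =
  ¬∀⟶∃¬ t _ (λ p → subset i p Bool.≟ subset j p)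
    (i≢j ∘ finToFun-injective 2 t ∘ (λ same p → Injection.injective (↔⇒↣ 2↔Bool) (same p)))

separated-family : ∀ (G : Graph n m) (σ : VarOrder n m) K (M : List (Fin m)) →
  All (CrossesPrefix G σ K) M →
  AllPairs (VertexDisjoint G) M →
  Σ (Fin (2 ^ length M) → Assignment n m) λ S →
    ∀ i j → i ≢ j → ¬ SameFunction G σ K (S i) (S j)
separated-family G σ K M crossing disjoint =
  select ∘ subset , λ i j i≢j → select-separates (proj₂ (subset-separates (length M) i≢j))
  where
  open Separation G σ K (lookup M)
    (λ p → crossing-ends (All.lookup crossing (∈-lookup p)))
    (AllPairs-lookup (VertexDisjoint-sym {G = G}) disjoint)

lemma3 : ∀ {n m} (G : Graph n m) (t : ℕ) → HasMatchingWidth G t →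
           ∀ (SF : VarOrder n m) →
           Σ ℕ λ k → k ≤ n + m ×
             Σ (Fin (2 ^ t) → Assignment n m) λ S →
               ∀ i j → i ≢ j → ¬ SameFunction G SF k (S i) (S j)
lemma3 G t (_ , wide-cut) SF
  with π , π-prefix ← induced-vertex-order SF
  with k , k≤n , M , (crossing , disjoint) , refl ← wide-cut π
  with K , K≤n+m , same-prefix ← π-prefix k k≤n
  = K , K≤n+m , separated-family G SF K M (All.map crosses-SF-prefix crossing) disjoint
  where
  -- the cut of π at k is the cut induced by the prefix of SF of length K
  crosses-SF-prefix : ∀ {e} → Crossing G π k e → CrossesPrefix G SF K e
  crosses-SF-prefix crosses same-side =
    crosses (trans (same-prefix _) (trans same-side (sym (same-prefix _))))
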